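{- Let $B$ be a Boolean algebra. Then $\widehat{B}$ is a Boolean dagger kernel category. Moreover, the assignment $B\mapsto\widehat{B}$, sending a Boolean algebra homomorphism $h\colon B\to C$ to the functor $\widehat{h}\colon\widehat{B}\to\widehat{C}$ given by $x\mapsto h(x)$ on objects and $f\mapsto h(f)$ on morphisms, is a functor from the category of Boolean algebras to the category of dagger kernel categories and their morphisms.
   Context: For a meet semilattice $B$ (with top $1$ and meet $\wedge$), the category $\widehat{B}$ has the elements of $B$ as objects; a morphism $x\to y$ is an element $f\in B$ with $f\le x\wedge y$; the identity on $x$ is $x$ and the composite of $f\colon x\to y$ and $g\colon y\to z$ is $f\wedge g$. It carries the dagger $f^\dagger=f$. A dagger category is a category with a contravariant functor $\dagger$ that is the identity on objects with $f^{\dagger\dagger}=f$; $f$ is a dagger mono if $f^\dagger\circ f=\mathrm{id}$. A dagger kernel category is a dagger category with a zero object in which every morphism has a kernel that can be chosen to be a dagger mono. It is Boolean if for all kernels $m,n$ with common codomain, $m\wedge n=0$ (meet in the poset of kernels, given by pullback) implies $m^\dagger\circ n=0$. A morphism of dagger kernel categories is a functor $F$ with $F(f^\dagger)=F(f)^\dagger$, sending the zero object to a zero object, and sending a kernel $k$ of $f$ to a kernel of $F(f)$. -}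

module Defs where

open import Level using (Level; _⊔_; suc)
open import Data.Product using (Σ; Σ-syntax; _×_; _,_; proj₁; proj₂)
open import Relation.Binary.Core using (Rel)
open import Relation.Binary.Structures using (IsEquivalence)
open import Relation.Binary.PropositionalEquality using (_≡_; subst₂)
open import Algebra.Lattice.Bundles using (BooleanAlgebra)
import Algebra.Lattice.Properties.Lattice as LatticeProps
import Relation.Binary.Reasoning.Setoid as SetoidReasoning

record Category (o ℓ e : Level) : Set (suc (o ⊔ ℓ ⊔ e)) where
  infixr 9 _∘_
  infix  4 _≈_
  field
    Obj       : Set o
    _⇒_       : Obj → Obj → Set ℓ
    _≈_       : ∀ {A B} → Rel (A ⇒ B) e
    id        : ∀ {A} → A ⇒ A
    _∘_       : ∀ {A B C} → B ⇒ C → A ⇒ B → A ⇒ C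
    equiv     : ∀ {A B} → IsEquivalence (_≈_ {A} {B})
    ∘-resp-≈  : ∀ {A B C} {f h : B ⇒ C} {g i : A ⇒ B} → f ≈ h → g ≈ i → f ∘ g ≈ h ∘ i
    assoc     : ∀ {A B C D} {f : A ⇒ B} {g : B ⇒ C} {h : C ⇒ D} →
                (h ∘ g) ∘ f ≈ h ∘ (g ∘ f)
    identityˡ : ∀ {A B} {f : A ⇒ B} → id ∘ f ≈ f
    identityʳ : ∀ {A B} {f : A ⇒ B} → f ∘ id ≈ f

record Functor {o ℓ e o′ ℓ′ e′} (C : Category o ℓ e) (D : Category o′ ℓ′ e′)
       : Set (o ⊔ ℓ ⊔ e ⊔ o′ ⊔ ℓ′ ⊔ e′) where
  private
    module C = Category C
    module D = Category D
  field
    F₀           : C.Obj → D.Obj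
    F₁           : ∀ {A B} → A C.⇒ B → F₀ A D.⇒ F₀ B
    F-resp-≈     : ∀ {A B} {f g : A C.⇒ B} → f C.≈ g → F₁ f D.≈ F₁ g
    identity     : ∀ {A} → F₁ (C.id {A}) D.≈ D.id
    homomorphism : ∀ {A B C} {f : A C.⇒ B} {g : B C.⇒ C} →
                   F₁ (g C.∘ f) D.≈ F₁ g D.∘ F₁ f

idF : ∀ {o ℓ e} (C : Category o ℓ e) → Functor C C
idF C = record
  { F₀ = λ A → A ; F₁ = λ f → f ; F-resp-≈ = λ p → p
  ; identity = IsEquivalence.refl equiv
  ; homomorphism = IsEquivalence.refl equiv }
  where open Category C

_∘F_ : ∀ {o ℓ e o′ ℓ′ e′ o″ ℓ″ e″}
         {C : Category o ℓ e} {D : Category o′ ℓ′ e′} {E : Category o″ ℓ″ e″} →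
       Functor D E → Functor C D → Functor C E
_∘F_ {C = C} {D} {E} G F = record
  { F₀ = λ A → G.F₀ (F.F₀ A)
  ; F₁ = λ f → G.F₁ (F.F₁ f)
  ; F-resp-≈ = λ p → G.F-resp-≈ (F.F-resp-≈ p)
  ; identity = IsEquivalence.trans E.equiv (G.F-resp-≈ F.identity) G.identity
  ; homomorphism = IsEquivalence.trans E.equiv (G.F-resp-≈ F.homomorphism) G.homomorphism }
  where
    module F = Functor F
    module G = Functor G
    module E = Category E

_≡F_ : ∀ {o ℓ e o′ ℓ′ e′} {C : Category o ℓ e} {D : Category o′ ℓ′ e′} →
       Functor C D → Functor C D → Set (o ⊔ ℓ ⊔ o′ ⊔ e′)
_≡F_ {C = C} {D} F G =
  Σ[ eq₀ ∈ (∀ A → F.F₀ A ≡ G.F₀ A) ]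
    (∀ {A B} (f : A C.⇒ B) →
       subst₂ D._⇒_ (eq₀ A) (eq₀ B) (F.F₁ f) D.≈ G.F₁ f)
  where
    module C = Category C
    module D = Category D
    module F = Functor F
    module G = Functor G

record DaggerCategory (o ℓ e : Level) : Set (suc (o ⊔ ℓ ⊔ e)) where
  field
    category : Category o ℓ e
  open Category category public
  field
    _†          : ∀ {A B} → A ⇒ B → B ⇒ A
    †-resp-≈    : ∀ {A B} {f g : A ⇒ B} → f ≈ g → f † ≈ g †
    †-identity  : ∀ {A} → (id {A}) † ≈ id
    †-homomorphism : ∀ {A B C} {f : A ⇒ B} {g : B ⇒ C} → (g ∘ f) † ≈ (f †) ∘ (g †)
    †-involutive : ∀ {A B} {f : A ⇒ B} → (f †) † ≈ f

  IsDaggerMono : ∀ {A B} → A ⇒ B → Set e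
  IsDaggerMono f = (f †) ∘ f ≈ id

module CatNotions {o ℓ e} (C : Category o ℓ e) where
  open Category C

  IsZeroObject : Obj → Set (o ⊔ ℓ ⊔ e)
  IsZeroObject Z = ∀ A → (Σ[ f ∈ Z ⇒ A ] (∀ g → g ≈ f))
                       × (Σ[ f ∈ A ⇒ Z ] (∀ g → g ≈ f))

  module WithZero (Z : Obj) (isZ : IsZeroObject Z) where

    0[_,_] : ∀ A B → A ⇒ B
    0[ A , B ] = proj₁ (proj₁ (isZ B)) ∘ proj₁ (proj₂ (isZ A))

    IsKernel : ∀ {A B K} → A ⇒ B → K ⇒ A → Set (o ⊔ ℓ ⊔ e)
    IsKernel {A} {B} {K} f k =
      (f ∘ k ≈ 0[ K , B ]) ×
      (∀ {X} (g : X ⇒ A) → f ∘ g ≈ 0[ X , B ] →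
         Σ[ h ∈ X ⇒ K ] ((k ∘ h ≈ g) × (∀ h′ → k ∘ h′ ≈ g → h′ ≈ h)))

    IsKernelMorphism : ∀ {K A} → K ⇒ A → Set (o ⊔ ℓ ⊔ e)
    IsKernelMorphism {K} {A} k = Σ[ X ∈ Obj ] Σ[ f ∈ A ⇒ X ] IsKernel f k

  IsPullback : ∀ {M N A P} → M ⇒ A → N ⇒ A → P ⇒ M → P ⇒ N → Set (o ⊔ ℓ ⊔ e)
  IsPullback {M} {N} {A} {P} m n p q =
    (m ∘ p ≈ n ∘ q) ×
    (∀ {X} (a : X ⇒ M) (b : X ⇒ N) → m ∘ a ≈ n ∘ b →
       Σ[ u ∈ X ⇒ P ] (((p ∘ u ≈ a) × (q ∘ u ≈ b))
                        × (∀ u′ → p ∘ u′ ≈ a → q ∘ u′ ≈ b → u′ ≈ u)))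

record IsDaggerKernelCategory {o ℓ e} (𝒟 : DaggerCategory o ℓ e)
       : Set (o ⊔ ℓ ⊔ e) where
  open DaggerCategory 𝒟 public
  open CatNotions category public
  field
    zeroObj : Obj
    isZero  : IsZeroObject zeroObj
  open WithZero zeroObj isZero public
  field
    kernel  : ∀ {A B} (f : A ⇒ B) →
              Σ[ K ∈ Obj ] Σ[ k ∈ K ⇒ A ] (IsKernel f k × IsDaggerMono k)

-- Boolean: for kernels m, n with common codomain, if their meet (given by
-- pullback) is 0, i.e. a pullback (P , p , q) of m and n exists whose
-- induced subobject m ∘ p : P → A is the zero subobject, then m† ∘ n = 0.
IsBoolean : ∀ {o ℓ e} {𝒟 : DaggerCategory o ℓ e} →
            IsDaggerKernelCategory 𝒟 → Set (o ⊔ ℓ ⊔ e)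
IsBoolean 𝒦 =
  ∀ {M N A} (m : M ⇒ A) (n : N ⇒ A) →
    IsKernelMorphism m → IsKernelMorphism n →
    (Σ[ P ∈ Obj ] Σ[ p ∈ P ⇒ M ] Σ[ q ∈ P ⇒ N ]
       (IsPullback m n p q × (m ∘ p ≈ 0[ P , A ]))) →
    (m †) ∘ n ≈ 0[ N , M ]
  where open IsDaggerKernelCategory 𝒦

record IsDKCMorphism {o ℓ e o′ ℓ′ e′}
       {𝒞 : DaggerCategory o ℓ e} {𝒟 : DaggerCategory o′ ℓ′ e′}
       (𝒦 : IsDaggerKernelCategory 𝒞) (ℒ : IsDaggerKernelCategory 𝒟)
       (F : Functor (DaggerCategory.category 𝒞) (DaggerCategory.category 𝒟))
       : Set (o ⊔ ℓ ⊔ e ⊔ o′ ⊔ ℓ′ ⊔ e′) where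
  private
    module 𝒦 = IsDaggerKernelCategory 𝒦
    module ℒ = IsDaggerKernelCategory ℒ
  open Functor F
  field
    preserves-†      : ∀ {A B} (f : A 𝒦.⇒ B) → F₁ (f 𝒦.†) ℒ.≈ (F₁ f) ℒ.†
    preserves-zero   : ℒ.IsZeroObject (F₀ 𝒦.zeroObj)
    preserves-kernel : ∀ {A B K} (f : A 𝒦.⇒ B) (k : K 𝒦.⇒ A) →
                       𝒦.IsKernel f k → ℒ.IsKernel (F₁ f) (F₁ k)

record BAHom {c ℓ c′ ℓ′} (B : BooleanAlgebra c ℓ) (C : BooleanAlgebra c′ ℓ′)
       : Set (c ⊔ ℓ ⊔ c′ ⊔ ℓ′) where
  private
    module B = BooleanAlgebra B
    module C = BooleanAlgebra C
  field
    ⟦_⟧    : B.Carrier → C.Carrier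
    cong   : ∀ {x y} → x B.≈ y → ⟦ x ⟧ C.≈ ⟦ y ⟧
    ∧-homo : ∀ x y → ⟦ x B.∧ y ⟧ C.≈ ⟦ x ⟧ C.∧ ⟦ y ⟧
    ∨-homo : ∀ x y → ⟦ x B.∨ y ⟧ C.≈ ⟦ x ⟧ C.∨ ⟦ y ⟧
    ¬-homo : ∀ x → ⟦ B.¬ x ⟧ C.≈ C.¬ ⟦ x ⟧
    ⊤-homo : ⟦ B.⊤ ⟧ C.≈ C.⊤
    ⊥-homo : ⟦ B.⊥ ⟧ C.≈ C.⊥

idBA : ∀ {c ℓ} (B : BooleanAlgebra c ℓ) → BAHom B B
idBA B = record
  { ⟦_⟧ = λ x → x ; cong = λ p → p
  ; ∧-homo = λ _ _ → refl′ ; ∨-homo = λ _ _ → refl′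
  ; ¬-homo = λ _ → refl′ ; ⊤-homo = refl′ ; ⊥-homo = refl′ }
  where open BooleanAlgebra B renaming (refl to refl′)

_∘BA_ : ∀ {c₁ ℓ₁ c₂ ℓ₂ c₃ ℓ₃}
          {B : BooleanAlgebra c₁ ℓ₁} {C : BooleanAlgebra c₂ ℓ₂} {D : BooleanAlgebra c₃ ℓ₃} →
        BAHom C D → BAHom B C → BAHom B D
_∘BA_ {D = D} g h = record
  { ⟦_⟧ = λ x → G.⟦ H.⟦ x ⟧ ⟧
  ; cong = λ p → G.cong (H.cong p)
  ; ∧-homo = λ x y → D.trans (G.cong (H.∧-homo x y)) (G.∧-homo _ _)
  ; ∨-homo = λ x y → D.trans (G.cong (H.∨-homo x y)) (G.∨-homo _ _)
  ; ¬-homo = λ x → D.trans (G.cong (H.¬-homo x)) (G.¬-homo _)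
  ; ⊤-homo = D.trans (G.cong H.⊤-homo) G.⊤-homo
  ; ⊥-homo = D.trans (G.cong H.⊥-homo) G.⊥-homo }
  where
    module G = BAHom g
    module H = BAHom h
    module D = BooleanAlgebra D

module Hat {c ℓ} (B : BooleanAlgebra c ℓ) where
  open BooleanAlgebra B
  open LatticeProps lattice using (∧-idem)
  open SetoidReasoning setoid

  infix 4 _≤_
  _≤_ : Carrier → Carrier → Set ℓ
  a ≤ b = a ∧ b ≈ a

  Hom : Carrier → Carrier → Set (c ⊔ ℓ)
  Hom x y = Σ[ f ∈ Carrier ] (f ≤ x ∧ y)

  ≤-trans : ∀ {a b d} → a ≤ b → b ≤ d → a ≤ d
  ≤-trans {a} {b} {d} p q = begin
    a ∧ d        ≈⟨ ∧-congʳ p ⟨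
    (a ∧ b) ∧ d  ≈⟨ ∧-assoc a b d ⟩
    a ∧ (b ∧ d)  ≈⟨ ∧-congˡ q ⟩
    a ∧ b        ≈⟨ p ⟩
    a            ∎

  ≤-meet : ∀ {a b d} → a ≤ b → a ≤ d → a ≤ b ∧ d
  ≤-meet {a} {b} {d} p q = begin
    a ∧ (b ∧ d)  ≈⟨ ∧-assoc a b d ⟨
    (a ∧ b) ∧ d  ≈⟨ ∧-congʳ p ⟩
    a ∧ d        ≈⟨ q ⟩
    a            ∎

  ∧≤ˡ : ∀ a b → a ∧ b ≤ a
  ∧≤ˡ a b = begin
    (a ∧ b) ∧ a  ≈⟨ ∧-comm (a ∧ b) a ⟩
    a ∧ (a ∧ b)  ≈⟨ ∧-assoc a a b ⟨
    (a ∧ a) ∧ b  ≈⟨ ∧-congʳ (∧-idem a) ⟩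
    a ∧ b        ∎

  ∧≤ʳ : ∀ a b → a ∧ b ≤ b
  ∧≤ʳ a b = begin
    (a ∧ b) ∧ b  ≈⟨ ∧-assoc a b b ⟩
    a ∧ (b ∧ b)  ≈⟨ ∧-congˡ (∧-idem b) ⟩
    a ∧ b        ∎

  hid : ∀ {x} → Hom x x
  hid {x} = x , (begin
    x ∧ (x ∧ x)  ≈⟨ ∧-congˡ (∧-idem x) ⟩
    x ∧ x        ≈⟨ ∧-idem x ⟩
    x            ∎)

  _∘h_ : ∀ {x y z} → Hom y z → Hom x y → Hom x z
  _∘h_ {x} {y} {z} (g , pg) (f , pf) = f ∧ g ,
    ≤-meet (≤-trans (∧≤ˡ f g) (≤-trans pf (∧≤ˡ x y)))
           (≤-trans (∧≤ʳ f g) (≤-trans pg (∧≤ʳ y z)))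

  category : Category c (c ⊔ ℓ) ℓ
  category = record
    { Obj = Carrier
    ; _⇒_ = Hom
    ; _≈_ = λ f g → proj₁ f ≈ proj₁ g
    ; id = hid
    ; _∘_ = _∘h_
    ; equiv = record { refl = refl ; sym = sym ; trans = trans }
    ; ∘-resp-≈ = λ p q → ∧-cong q p
    ; assoc = λ {A} {B′} {C} {D} {f} {g} {h} → ∧-assoc (proj₁ f) (proj₁ g) (proj₁ h) ⟨$⟩sym
    ; identityˡ = λ {A} {B′} {f} → ≤-trans (proj₂ f) (∧≤ʳ A B′) ⟨$⟩id
    ; identityʳ = λ {A} {B′} {f} → trans (∧-comm A (proj₁ f)) (≤-trans (proj₂ f) (∧≤ˡ A B′))
    }
    where
      _⟨$⟩sym : ∀ {a b} → a ≈ b → b ≈ a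
      p ⟨$⟩sym = sym p
      _⟨$⟩id : ∀ {a b} → a ≈ b → a ≈ b
      p ⟨$⟩id = p

  daggerCategory : DaggerCategory c (c ⊔ ℓ) ℓ
  daggerCategory = record
    { category = category
    ; _† = λ {x} {y} f → proj₁ f , trans (∧-congˡ (∧-comm y x)) (proj₂ f)
    ; †-resp-≈ = λ p → p
    ; †-identity = refl
    ; †-homomorphism = λ {A} {B′} {C} {f} {g} → ∧-comm (proj₁ f) (proj₁ g)
    ; †-involutive = refl
    }

hatF : ∀ {c ℓ c′ ℓ′} {B : BooleanAlgebra c ℓ} {C : BooleanAlgebra c′ ℓ′} →
       BAHom B C → Functor (Hat.category B) (Hat.category C)
hatF {B = B} {C} h = record
  { F₀ = λ x → ⟦ x ⟧
  ; F₁ = λ {x} {y} f →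
      ⟦ proj₁ f ⟧ ,
      C.trans (C.sym (C.trans (∧-homo (proj₁ f) (x B.∧ y))
                              (C.∧-congˡ (∧-homo x y))))
              (cong (proj₂ f))
  ; F-resp-≈ = cong
  ; identity = C.refl
  ; homomorphism = λ {A} {B′} {C′} {f} {g} → ∧-homo (proj₁ f) (proj₁ g)
  }
  where
    open BAHom h
    module B = BooleanAlgebra B
    module C = BooleanAlgebra C

module Submission where

-- Everything below reduces
-- categorical notions in B̂ to order theory in B:
--
--   * an object z is a zero object as soon as z ≈ ⊥, and then every zero
--     morphism has underlying element ⊥ ∧ ⊥, so "f ∘ g = 0" means g ∧ f ≈ ⊥;
--   * k : K → A is a kernel of f : A → B exactly when k ≈ K ≈ A ∧ ¬ f
--     (the Galois connection a ∧ b ≈ ⊥ ⇔ a ≤ ¬ b does the work);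
--   * the canonical kernel A ∧ ¬ f is an idempotent, hence a dagger mono;
--   * Booleanness: a pullback of m and n sees the common lower bound n ∧ m,
--     which therefore lies below the (zero) meet, so m† ∘ n = n ∧ m = 0;
--   * a Boolean algebra homomorphism preserves ⊥ and the element A ∧ ¬ f,
--     so the kernel characterisation transports along it; functoriality of
--     B ↦ B̂ holds on the nose.

open import Defs
open import Level using (Level)
open import Data.Product using (Σ-syntax; _×_; _,_; proj₁; proj₂)
open import Algebra.Lattice.Bundles using (BooleanAlgebra)
open import Relation.Binary.PropositionalEquality using () renaming (refl to ≡-refl)
import Algebra.Lattice.Properties.BooleanAlgebra as BooleanAlgebraProperties
import Relation.Binary.Reasoning.Setoid as SetoidReasoning

module HatStructure {c ℓ} (B : BooleanAlgebra c ℓ) where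
  open BooleanAlgebra B
  open BooleanAlgebraProperties B using (∧-zeroʳ; ∧-zeroˡ; ∧-identityʳ; ∨-identityˡ; ∧-idem)
  open Hat B
  open SetoidReasoning setoid

  ≤-refl : ∀ a → a ≤ a
  ≤-refl = ∧-idem

  ≤-resp-≈ : ∀ {a a′ b b′} → a ≈ a′ → b ≈ b′ → a ≤ b → a′ ≤ b′
  ≤-resp-≈ a≈a′ b≈b′ a≤b = trans (sym (∧-cong a≈a′ b≈b′)) (trans a≤b a≈a′)

  ≤-antisym : ∀ {a b} → a ≤ b → b ≤ a → a ≈ b
  ≤-antisym {a} {b} a≤b b≤a = trans (sym a≤b) (trans (∧-comm a b) b≤a)

  ≤⊥⇒≈⊥ : ∀ {a} → a ≤ ⊥ → a ≈ ⊥
  ≤⊥⇒≈⊥ {a} a≤⊥ = trans (sym a≤⊥) (∧-zeroʳ a)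

  -- The Galois connection behind kernels:  a ∧ b ≈ ⊥  iff  a ≤ ¬ b.
  disjoint⇒≤¬ : ∀ {a b} → a ∧ b ≈ ⊥ → a ≤ ¬ b
  disjoint⇒≤¬ {a} {b} a∧b≈⊥ = begin
    a ∧ ¬ b                ≈⟨ ∨-identityˡ (a ∧ ¬ b) ⟨
    ⊥ ∨ a ∧ ¬ b            ≈⟨ ∨-congʳ a∧b≈⊥ ⟨
    a ∧ b ∨ a ∧ ¬ b        ≈⟨ ∧-distribˡ-∨ a b (¬ b) ⟨
    a ∧ (b ∨ ¬ b)          ≈⟨ ∧-congˡ (∨-complementʳ b) ⟩
    a ∧ ⊤                  ≈⟨ ∧-identityʳ a ⟩
    a                      ∎

  ≤¬⇒disjoint : ∀ {a b} → a ≤ ¬ b → a ∧ b ≈ ⊥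
  ≤¬⇒disjoint {a} {b} a≤¬b = begin
    a ∧ b                  ≈⟨ ∧-congʳ a≤¬b ⟨
    (a ∧ ¬ b) ∧ b          ≈⟨ ∧-assoc a (¬ b) b ⟩
    a ∧ (¬ b ∧ b)          ≈⟨ ∧-congˡ (∧-complementˡ b) ⟩
    a ∧ ⊥                  ≈⟨ ∧-zeroʳ a ⟩
    ⊥                      ∎

  ≤dom : ∀ {x y} (f : Hom x y) → proj₁ f ≤ x
  ≤dom {x} {y} (f , f≤x∧y) = ≤-trans f≤x∧y (∧≤ˡ x y)

  ≤cod : ∀ {x y} (f : Hom x y) → proj₁ f ≤ y
  ≤cod {x} {y} (f , f≤x∧y) = ≤-trans f≤x∧y (∧≤ʳ x y)

  inclusion : ∀ {a A} → a ≤ A → Hom a A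
  inclusion {a} a≤A = a , ≤-meet (≤-refl a) a≤A

  isZeroAt : ∀ {z} → z ≈ ⊥ → CatNotions.IsZeroObject category z
  isZeroAt {z} z≈⊥ A =
    ((⊥ , ∧-zeroˡ (z ∧ A)) , λ g → ≤⊥⇒≈⊥ (≤-trans (≤dom g) z≤⊥)) ,
    ((⊥ , ∧-zeroˡ (A ∧ z)) , λ g → ≤⊥⇒≈⊥ (≤-trans (≤cod g) z≤⊥))
    where
      z≤⊥ : z ≤ ⊥
      z≤⊥ = ≤-resp-≈ (sym z≈⊥) refl (≤-refl ⊥)

  open CatNotions category
  open WithZero ⊥ (isZeroAt refl)

  -- With ⊥ as zero object every zero morphism is ⊥ ∧ ⊥ ≈ ⊥, so a composite
  -- f ∘ g is zero exactly when the underlying elements are disjoint.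
  ≈0⇒≈⊥ : ∀ {a} → a ≈ ⊥ ∧ ⊥ → a ≈ ⊥
  ≈0⇒≈⊥ a≈0 = trans a≈0 (∧-idem ⊥)

  ≈⊥⇒≈0 : ∀ {a} → a ≈ ⊥ → a ≈ ⊥ ∧ ⊥
  ≈⊥⇒≈0 a≈⊥ = trans a≈⊥ (sym (∧-idem ⊥))

  kernelElement : ∀ {A B′} → Hom A B′ → Carrier
  kernelElement {A} (f , _) = A ∧ ¬ f

  kernel-intro : ∀ {A B′ K} (f : Hom A B′) (k : Hom K A) →
                 proj₁ k ≈ kernelElement f → K ≈ kernelElement f → IsKernel f k
  kernel-intro {A} {K = K} (f , _) (k , _) k≈A∧¬f K≈A∧¬f =
    ≈⊥⇒≈0 (≤¬⇒disjoint k≤¬f) , factor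
    where
      k≤¬f : k ≤ ¬ f
      k≤¬f = ≤-resp-≈ (sym k≈A∧¬f) refl (∧≤ʳ A (¬ f))
      factor : ∀ {X} (g : Hom X A) → proj₁ g ∧ f ≈ ⊥ ∧ ⊥ →
               Σ[ u ∈ Hom X K ] ((proj₁ u ∧ k ≈ proj₁ g)
                                 × (∀ u′ → proj₁ u′ ∧ k ≈ proj₁ g → proj₁ u′ ≈ proj₁ u))
      factor {X} g g∧f≈0 = (proj₁ g , ≤-meet (≤dom g) g≤K) , g≤k , unique
        where
          g≤A∧¬f : proj₁ g ≤ A ∧ ¬ f
          g≤A∧¬f = ≤-meet (≤cod g) (disjoint⇒≤¬ (≈0⇒≈⊥ g∧f≈0))
          g≤K = ≤-resp-≈ refl (sym K≈A∧¬f) g≤A∧¬f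
          g≤k = ≤-resp-≈ refl (sym k≈A∧¬f) g≤A∧¬f
          -- any u′ : X → K lies below K ≈ k, so u′ ∧ k is u′ itself
          unique : ∀ (u′ : Hom X K) → proj₁ u′ ∧ k ≈ proj₁ g → proj₁ u′ ≈ proj₁ g
          unique u′ u′∧k≈g =
            trans (sym (≤-resp-≈ refl (trans K≈A∧¬f (sym k≈A∧¬f)) (≤cod u′))) u′∧k≈g

  -- Conversely, uniqueness of factorisations through a kernel k : K → A
  -- forces k ≈ K (both id and k factor k through itself), and the universal
  -- property applied to the inclusion of A ∧ ¬ f gives A ∧ ¬ f ≤ k.
  kernel-elim : ∀ {A B′ K} (f : Hom A B′) (k : Hom K A) → IsKernel f k →
                (proj₁ k ≈ kernelElement f) × (K ≈ kernelElement f)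
  kernel-elim {A} {K = K} (f , _) (k , pk) (k∧f≈0 , factor) =
    k≈A∧¬f , trans (sym k≈K) k≈A∧¬f
    where
      unique : ∀ (u : Hom K K) → proj₁ u ∧ k ≈ k →
               proj₁ u ≈ proj₁ (proj₁ (factor (k , pk) k∧f≈0))
      unique = proj₂ (proj₂ (factor (k , pk) k∧f≈0))
      k≈K : k ≈ K
      k≈K = trans (unique (k , ≤-meet (≤dom (k , pk)) (≤dom (k , pk))) (∧-idem k))
                  (sym (unique hid (trans (∧-comm K k) (≤dom (k , pk)))))
      ¬f-inclusion : Hom (A ∧ ¬ f) A
      ¬f-inclusion = inclusion (∧≤ˡ A (¬ f))
      through-k = factor ¬f-inclusion (≈⊥⇒≈0 (≤¬⇒disjoint (∧≤ʳ A (¬ f))))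
      A∧¬f≤k : A ∧ ¬ f ≤ k
      A∧¬f≤k = ≤-resp-≈ (proj₁ (proj₂ through-k)) refl (∧≤ʳ (proj₁ (proj₁ through-k)) k)
      k≈A∧¬f : k ≈ A ∧ ¬ f
      k≈A∧¬f = ≤-antisym (≤-meet (≤cod (k , pk)) (disjoint⇒≤¬ (≈0⇒≈⊥ k∧f≈0))) A∧¬f≤k

  -- B̂ is a dagger kernel category: zero object ⊥, kernel of f the inclusion
  -- of A ∧ ¬ f, which is a dagger mono because meets are idempotent.
  isDaggerKernelCategory : IsDaggerKernelCategory daggerCategory
  isDaggerKernelCategory = record
    { zeroObj = ⊥
    ; isZero  = isZeroAt refl
    ; kernel  = λ {A} f →
        let k = inclusion (∧≤ˡ A (¬ proj₁ f)) in
        kernelElement f , k , kernel-intro f k refl refl , ∧-idem (kernelElement f)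
    }

  -- The elements n ∧ m, viewed as morphisms into M and into N,
  -- form a cone over m and n; its mediating morphism u into the pullback
  -- exhibits n ∧ m ≈ (u ∧ p) ∧ m ≈ u ∧ ⊥.
  isBoolean : IsBoolean isDaggerKernelCategory
  isBoolean {M} {N} (m , pm) (n , pn) _ _ (_ , (p , _) , _ , (_ , mediate) , m∘p≈0) =
    ≈⊥⇒≈0 (begin
      n ∧ m          ≈⟨ ∧≤ʳ n m ⟨
      (n ∧ m) ∧ m    ≈⟨ ∧-congʳ u∧p≈n∧m ⟨
      (u ∧ p) ∧ m    ≈⟨ ∧-assoc u p m ⟩
      u ∧ (p ∧ m)    ≈⟨ ∧-congˡ (≈0⇒≈⊥ m∘p≈0) ⟩
      u ∧ ⊥          ≈⟨ ∧-zeroʳ u ⟩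
      ⊥              ∎)
    where
      toM : Hom (n ∧ m) M
      toM = inclusion (≤-trans (∧≤ʳ n m) (≤dom (m , pm)))
      toN : Hom (n ∧ m) N
      toN = inclusion (≤-trans (∧≤ˡ n m) (≤dom (n , pn)))
      cone = mediate toM toN (trans (∧≤ʳ n m) (sym (∧≤ˡ n m)))
      u = proj₁ (proj₁ cone)
      u∧p≈n∧m : u ∧ p ≈ n ∧ m
      u∧p≈n∧m = proj₁ (proj₁ (proj₂ cone))

open HatStructure using (isDaggerKernelCategory; isBoolean)

-- A Boolean algebra homomorphism h induces a morphism ĥ of dagger kernel
-- categories: it commutes with the (trivial) dagger, sends ⊥ to ⊥, and
-- sends the kernel element A ∧ ¬ f to h A ∧ ¬ h f.
hatF-isDKCMorphism : ∀ {c ℓ c′ ℓ′} (B : BooleanAlgebra c ℓ) (C : BooleanAlgebra c′ ℓ′)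
                     (h : BAHom B C) →
                     IsDKCMorphism (isDaggerKernelCategory B) (isDaggerKernelCategory C) (hatF h)
hatF-isDKCMorphism B C h = record
  { preserves-†      = λ _ → C.refl
  ; preserves-zero   = HatStructure.isZeroAt C ⊥-homo
  ; preserves-kernel = λ f k isKernel →
      let (k≈A∧¬f , K≈A∧¬f) = HatStructure.kernel-elim B f k isKernel in
      HatStructure.kernel-intro C (F₁ f) (F₁ k)
        (C.trans (cong k≈A∧¬f) (preserves-kernelElement f))
        (C.trans (cong K≈A∧¬f) (preserves-kernelElement f))
  }
  where
    open BAHom h
    open Functor (hatF h) using (F₁)
    module B = BooleanAlgebra B
    module C = BooleanAlgebra C
    preserves-kernelElement : ∀ {A B′} (f : Hat.Hom B A B′) →
      ⟦ HatStructure.kernelElement B f ⟧ C.≈ HatStructure.kernelElement C (F₁ f)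
    preserves-kernelElement {A} (f , _) =
      C.trans (∧-homo A (B.¬ f)) (C.∧-congˡ (¬-homo f))

hatF-identity : ∀ {c ℓ} (B : BooleanAlgebra c ℓ) → hatF (idBA B) ≡F idF (Hat.category B)
hatF-identity B = (λ _ → ≡-refl) , λ _ → BooleanAlgebra.refl B

hatF-composition : ∀ {c₁ ℓ₁ c₂ ℓ₂ c₃ ℓ₃} (B : BooleanAlgebra c₁ ℓ₁)
                   (C : BooleanAlgebra c₂ ℓ₂) (D : BooleanAlgebra c₃ ℓ₃)
                   (h : BAHom B C) (g : BAHom C D) →
                   hatF (g ∘BA h) ≡F (hatF g ∘F hatF h)
hatF-composition B C D h g = (λ _ → ≡-refl) , λ _ → BooleanAlgebra.refl D

proposition3p5 : ∀ {c ℓ : Level} →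
    Σ[ 𝒦 ∈ ((B : BooleanAlgebra c ℓ) → IsDaggerKernelCategory (Hat.daggerCategory B)) ]
    (((B : BooleanAlgebra c ℓ) → IsBoolean (𝒦 B))
    × ((B C : BooleanAlgebra c ℓ) (h : BAHom B C) → IsDKCMorphism (𝒦 B) (𝒦 C) (hatF h))
    × ((B : BooleanAlgebra c ℓ) → hatF (idBA B) ≡F idF (Hat.category B))
    × ((B C D : BooleanAlgebra c ℓ) (h : BAHom B C) (g : BAHom C D) →
    hatF (g ∘BA h) ≡F (hatF g ∘F hatF h)))
proposition3p5 =
  isDaggerKernelCategory ,
  isBoolean ,
  hatF-isDKCMorphism ,
  hatF-identity ,
  hatF-composition
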